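{- Let $n\geq1$ and let $x\neq y$ be two bitstrings of length $n$ with finite block code that lie on the same chain of the Greene–Kleitman SCD $D_n$. Then for every integer $k\geq 0$, the bitstrings $\sigma^k(\overline{x})$ and $\sigma^k(\overline{y})$ do not lie on the same chain of $D_n$.
   Context: Bitstrings $x=x_1\cdots x_n\in\{0,1\}^n$ represent subsets of $[n]$; $\overline{x}$ is the bitwise complement and $\sigma(x_1\cdots x_n)=x_nx_1\cdots x_{n-1}$ is cyclic right rotation. Reading each 0 as an opening and each 1 as a closing parenthesis and matching closest pairs in the usual way, $M(x)$ is the set of index pairs of matched parentheses and $U_0(x)$, $U_1(x)$ are the index sets of unmatched 0s and 1s. If $U_0(x)\ne\emptyset$, $\tau(x)$ is obtained by flipping the leftmost unmatched 0 to 1. The Greene–Kleitman SCD $D_n$ of $Q_n$ consists of the chains $(x,\tau(x),\dots,\tau^{k}(x))$ for all $x$ with $U_1(x)=\emptyset$ and $k=|U_0(x)|$. The block code of $x$ is finite if $x$ has the form $1^{a_1}0^{b_1}\cdots1^{a_r}0^{b_r}$ with $r\ge1$ and all $a_i,b_i\ge1$ (equivalently, $x$ starts with 1 and ends with 0). -}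

module Defs where

open import Data.Bool using (Bool; true; false; not)
open import Data.Nat using (ℕ; zero; suc; _≤_; _≥_; _≡ᵇ_)
open import Data.List as L using (List; []; _∷_; length; filter)
open import Data.List.Membership.DecPropositional (Data.Nat._≟_) using (_∈?_)
open import Data.Vec as V using (Vec; []; _∷_)
open import Data.Product using (Σ; _×_; _,_; ∃)
open import Relation.Nullary using (¬_)
open import Relation.Nullary.Decidable using (⌊_⌋)
open import Relation.Binary.PropositionalEquality using (_≡_)
open import Data.Empty using (⊥)

-- Bitstrings of length n: Vec Bool n, with false = 0 and true = 1.
-- Positions are 0-based indices into the vector (index i ↔ paper's x_{i+1}).
Bits : ℕ → Set
Bits n = Vec Bool n

comp : ∀ {n} → Bits n → Bits n
comp = V.map not

σ : ∀ {n} → Bits n → Bits n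
σ {zero}  []       = []
σ {suc m} xs@(_ ∷ _) = V.last xs ∷ V.init xs

iter : ∀ {A : Set} → ℕ → (A → A) → A → A
iter zero    f a = a
iter (suc k) f a = f (iter k f a)

-- Parenthesis matching: 0 = '(' and 1 = ')'.
matchGo : List Bool → ℕ → List ℕ → List (ℕ × ℕ)
matchGo []           i stack       = []
matchGo (false ∷ bs) i stack       = matchGo bs (suc i) (i ∷ stack)
matchGo (true  ∷ bs) i []          = matchGo bs (suc i) []
matchGo (true  ∷ bs) i (p ∷ stack) = (p , i) ∷ matchGo bs (suc i) stack

M : ∀ {n} → Bits n → List (ℕ × ℕ)
M x = matchGo (V.toList x) 0 []

matchedIdx : List (ℕ × ℕ) → List ℕ
matchedIdx []             = []
matchedIdx ((i , j) ∷ ps) = i ∷ j ∷ matchedIdx ps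

positionsGo : Bool → List Bool → ℕ → List ℕ
positionsGo b []       i = []
positionsGo b (c ∷ cs) i with b Data.Bool.≟ c
... | Relation.Nullary.yes _ = i ∷ positionsGo b cs (suc i)
... | Relation.Nullary.no  _ = positionsGo b cs (suc i)

U : Bool → ∀ {n} → Bits n → List ℕ
U b x = filter (λ i → Relation.Nullary.¬? (i ∈? matchedIdx (M x)))
               (positionsGo b (V.toList x) 0)

U₀ U₁ : ∀ {n} → Bits n → List ℕ
U₀ = U false
U₁ = U true

setOne : ∀ {n} → ℕ → Bits n → Bits n
setOne i       []       = []
setOne zero    (_ ∷ bs) = true ∷ bs
setOne (suc i) (b ∷ bs) = b ∷ setOne i bs

-- τ(x): flip the leftmost unmatched 0 to 1.  τ is only used (below) when
-- U₀(x) ≠ ∅; on U₀(x) = ∅ it is made total as the identity (never used).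
τ : ∀ {n} → Bits n → Bits n
τ x with U₀ x
... | []    = x
... | i ∷ _ = setOne i x

-- z is the bottom of a chain of D_n iff U₁(z) = ∅; the chain is
-- (z, τ z, …, τ^k z) with k = |U₀(z)|.
-- x lies on the chain starting at z:
OnChain : ∀ {n} → Bits n → Bits n → Set
OnChain z x = Σ ℕ λ i → i ≤ length (U₀ z) × iter i τ z ≡ x

SameChain : ∀ {n} → Bits n → Bits n → Set
SameChain {n} x y =
  Σ (Bits n) λ z → U₁ z ≡ [] × OnChain z x × OnChain z y

-- finite block code: x = 1^{a_1}0^{b_1}⋯1^{a_r}0^{b_r}, r ≥ 1, a_i,b_i ≥ 1,
-- equivalently (as stated in the paper) x starts with 1 and ends with 0.
FiniteBlockCode : ∀ {n} → Bits n → Set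
FiniteBlockCode {zero}  []            = ⊥
FiniteBlockCode {suc m} xs@(b ∷ _) = b ≡ true × V.last xs ≡ false

-- Along a chain of D_n bits only flip from 0 to 1, each at the step where it
-- is the leftmost unmatched 0; such a 0 is followed by a 0 and, unless it is
-- the first bit, preceded by a 1.  If x lies below y, x starts with 1 and y
-- ends with 0, pick a maximal block [a, b] of positions where x is 0 and y is
-- 1; then x has a 1 at a - 1 and y a 0 at b + 1.  After complementing and
-- rotating, a common chain would have to put the image of y below that of x,
-- and the two rules above applied to the rising bits at a and b force both a
-- and b + 1 to be rotated onto position 0, contradicting a ≤ b.
module Submission where

open import Defs
open import Data.Bool using (Bool; true; false; not)
import Data.Bool as Bool
open import Data.Bool.Properties using (¬-not)
open import Data.Nat using (ℕ; zero; suc; _+_; _∸_; _≤_; _<_; _≥_; z≤n; s≤s; _≟_)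
open import Data.Nat.Properties
open import Data.List using (List; []; _∷_; length)
open import Data.List.Membership.Propositional using (_∈_; _∉_)
open import Data.List.Membership.Propositional.Properties using (∈-filter⁻; ∈-filter⁺)
open import Data.List.Membership.DecPropositional (Data.Nat._≟_) using (_∈?_)
open import Data.List.Relation.Unary.Any using (here; there)
open import Data.List.Relation.Unary.All as All using (All; []; _∷_)
open import Data.List.Relation.Unary.AllPairs using (AllPairs; []; _∷_)
import Data.List.Relation.Unary.AllPairs.Properties as AllPairs
open import Data.Vec as V using ([]; _∷_)
open import Data.Vec.Properties using (length-toList)
open import Data.Product using (∃-syntax; _×_; _,_; proj₁; proj₂; map; map₁)
open import Data.Sum using (_⊎_; inj₁; inj₂)
open import Function using (_∘_)
open import Relation.Nullary using (¬_; yes; no; ¬?; contradiction)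
open import Relation.Nullary.Decidable using (_×-dec_)
open import Relation.Unary using (Decidable)
open import Relation.Binary.PropositionalEquality

bitL : List Bool → ℕ → Bool
bitL []       _       = false
bitL (b ∷ bs) zero    = b
bitL (b ∷ bs) (suc i) = bitL bs i

-- Indices past the end read as 0.
bit : ∀ {n} → Bits n → ℕ → Bool
bit v = bitL (V.toList v)

bit-last : ∀ {m} (v : Bits (suc m)) → bit v m ≡ V.last v
bit-last {zero}  (b ∷ []) = refl
bit-last {suc m} (b ∷ v)  = bit-last v

bit-init : ∀ {m} (v : Bits (suc m)) i → i < m → bit (V.init v) i ≡ bit v i
bit-init {suc m} (b ∷ v) zero    _         = refl
bit-init {suc m} (b ∷ v) (suc i) (s≤s i<m) = bit-init v i i<m

bit-comp : ∀ {n} (v : Bits n) i → i < n → bit (comp v) i ≡ not (bit v i)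
bit-comp (b ∷ v) zero    _         = refl
bit-comp (b ∷ v) (suc i) (s≤s i<n) = bit-comp v i i<n

finiteBlockCode-ends : ∀ {m} {x : Bits (suc m)} → FiniteBlockCode x →
                       bit x 0 ≡ true × bit x m ≡ false
finiteBlockCode-ends {x = b ∷ bs} (b≡1 , last≡0) = b≡1 , trans (bit-last (b ∷ bs)) last≡0

-- Invariant of the stack of pending 0s in matchGo at scan index i.
data PendingStack : ℕ → List ℕ → Set where
  []  : ∀ {i} → PendingStack i []
  _∷_ : ∀ {i p st} → p < i → PendingStack p st → PendingStack i (p ∷ st)

pendingStack-weaken : ∀ {i j st} → i ≤ j → PendingStack i st → PendingStack j st
pendingStack-weaken i≤j []          = []
pendingStack-weaken i≤j (p<i ∷ ps) = ≤-trans p<i i≤j ∷ ps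

pendingStack-< : ∀ {i st p} → PendingStack i st → p ∈ st → p < i
pendingStack-< (p<i ∷ ps) (here refl) = p<i
pendingStack-< (p<i ∷ ps) (there p∈) = <-trans (pendingStack-< ps p∈) p<i

pendingStack-pop : ∀ {i p st} → PendingStack i (p ∷ st) → PendingStack (suc i) st
pendingStack-pop (p<i ∷ ps) = pendingStack-weaken (<⇒≤ (m<n⇒m<1+n p<i)) ps

matchGo-lifo : ∀ bs i st → PendingStack i st → ∀ {p q} → p ∈ st → q ∈ st → p < q →
               p ∈ matchedIdx (matchGo bs i st) → q ∈ matchedIdx (matchGo bs i st)
matchGo-lifo []           i st       ps p∈ q∈ p<q ()
matchGo-lifo (false ∷ bs) i st       ps p∈ q∈ p<q p✓ =
  matchGo-lifo bs (suc i) (i ∷ st) (≤-refl ∷ ps) (there p∈) (there q∈) p<q p✓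
matchGo-lifo (true ∷ bs)  i []       ps () q∈ p<q p✓
matchGo-lifo (true ∷ bs)  i (t ∷ st) ps p∈ (here refl) p<q p✓ = here refl
matchGo-lifo (true ∷ bs)  i (t ∷ st) (t<i ∷ ps) p∈ (there q∈) p<q p✓
  with p∈
... | here refl = contradiction (pendingStack-< ps q∈) (<-asym p<q)
... | there p∈st with p✓
...   | here refl = contradiction (pendingStack-< ps p∈st) (<-irrefl refl)
...   | there (here refl) = contradiction (pendingStack-< (t<i ∷ ps) p∈) (<-irrefl refl)
...   | there (there p✓′) =
  there (there (matchGo-lifo bs (suc i) st (pendingStack-pop (t<i ∷ ps)) p∈st q∈ p<q p✓′))

private
  ∈-resp-≡ : ∀ {a b} {xs : List ℕ} → a ≡ b → a ∈ xs → b ∈ xs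
  ∈-resp-≡ {xs = xs} = subst (_∈ xs)

  ∈-+-suc : ∀ {i j} {xs : List ℕ} → suc i + j ∈ xs → i + suc j ∈ xs
  ∈-+-suc {i} {j} = ∈-resp-≡ (sym (+-suc i j))

  ∈-+-suc⁻ : ∀ {i j} {xs : List ℕ} → i + suc j ∈ xs → suc i + j ∈ xs
  ∈-+-suc⁻ {i} {j} = ∈-resp-≡ (+-suc i j)

zero-one-matched : ∀ bs i st j → bitL bs j ≡ false → bitL bs (suc j) ≡ true →
                   i + j ∈ matchedIdx (matchGo bs i st)
zero-one-matched []                   i st j       _  ()
zero-one-matched (true ∷ bs)          i st zero    () _
zero-one-matched (false ∷ [])         i st zero    _  ()
zero-one-matched (false ∷ false ∷ bs) i st zero    _  ()
zero-one-matched (false ∷ true ∷ bs)  i st zero    _  _ = here (+-identityʳ i)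
zero-one-matched (b ∷ bs)             i st (suc j) 0ʲ 1ʲ⁺¹ =
  ∈-+-suc (matched-after-step b st (λ st′ → zero-one-matched bs (suc i) st′ j 0ʲ 1ʲ⁺¹))
  where
  matched-after-step : ∀ {q} b st → (∀ st′ → q ∈ matchedIdx (matchGo bs (suc i) st′)) →
                       q ∈ matchedIdx (matchGo (b ∷ bs) i st)
  matched-after-step false st       q✓ = q✓ (i ∷ st)
  matched-after-step true  []       q✓ = q✓ []
  matched-after-step true  (p ∷ st) q✓ = there (there (q✓ st))

zero-zero-matched-next : ∀ bs i st → PendingStack i st → ∀ j →
                    bitL bs j ≡ false → bitL bs (suc j) ≡ false →
                    i + j ∈ matchedIdx (matchGo bs i st) → i + suc j ∈ matchedIdx (matchGo bs i st)
zero-zero-matched-next []                   i st       ps         j       _  _    ()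
zero-zero-matched-next (true ∷ bs)          i st       ps         zero    () _    _
zero-zero-matched-next (false ∷ [])         i st       ps         zero    _  _    ()
zero-zero-matched-next (false ∷ true ∷ bs)  i st       ps         zero    _  ()   _
zero-zero-matched-next (false ∷ false ∷ bs) i st       ps         zero    _  _    j✓ =
  ∈-resp-≡ (+-comm 1 i)
    (matchGo-lifo bs (suc (suc i)) (suc i ∷ i ∷ st) (≤-refl ∷ ≤-refl ∷ ps)
       (there (here refl)) (here refl) (n<1+n i) (∈-resp-≡ (+-identityʳ i) j✓))
zero-zero-matched-next (false ∷ bs)         i st       ps         (suc j) 0ʲ 0ʲ⁺¹ j✓ =
  ∈-+-suc (zero-zero-matched-next bs (suc i) (i ∷ st) (≤-refl ∷ ps) j 0ʲ 0ʲ⁺¹ (∈-+-suc⁻ j✓))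
zero-zero-matched-next (true ∷ bs)          i []       ps         (suc j) 0ʲ 0ʲ⁺¹ j✓ =
  ∈-+-suc (zero-zero-matched-next bs (suc i) [] [] j 0ʲ 0ʲ⁺¹ (∈-+-suc⁻ j✓))
zero-zero-matched-next (true ∷ bs)          i (p ∷ st) (p<i ∷ ps) (suc j) 0ʲ 0ʲ⁺¹ (here p≡) =
  contradiction (<-≤-trans p<i (m≤m+n i (suc j))) (<-irrefl (sym p≡))
zero-zero-matched-next (true ∷ bs)          i (p ∷ st) ps         (suc j) 0ʲ 0ʲ⁺¹ (there (here i≡)) =
  contradiction (subst (i <_) (sym (+-suc i j)) (s≤s (m≤m+n i j))) (<-irrefl (sym i≡))
zero-zero-matched-next (true ∷ bs)          i (p ∷ st) ps         (suc j) 0ʲ 0ʲ⁺¹ (there (there j✓)) =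
  there (there (∈-+-suc (zero-zero-matched-next bs (suc i) st (pendingStack-pop ps) j 0ʲ 0ʲ⁺¹ (∈-+-suc⁻ j✓))))

positionsGo-∷ : ∀ b c cs i {q} → q ∈ positionsGo b (c ∷ cs) i →
                (q ≡ i × c ≡ b) ⊎ q ∈ positionsGo b cs (suc i)
positionsGo-∷ b c cs i q∈ with b Bool.≟ c
positionsGo-∷ b c cs i (here q≡i)  | yes refl = inj₁ (q≡i , refl)
positionsGo-∷ b c cs i (there q∈′) | yes _    = inj₂ q∈′
positionsGo-∷ b c cs i q∈          | no _     = inj₂ q∈

positionsGo-sound : ∀ b cs i {q} → q ∈ positionsGo b cs i →
                    ∃[ k ] q ≡ i + k × bitL cs k ≡ b × k < length cs
positionsGo-sound b (c ∷ cs) i q∈ with positionsGo-∷ b c cs i q∈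
... | inj₁ (refl , refl) = 0 , sym (+-identityʳ i) , refl , s≤s z≤n
... | inj₂ q∈′ with positionsGo-sound b cs (suc i) q∈′
...   | k , refl , cₖ , k< = suc k , sym (+-suc i k) , cₖ , s≤s k<

positionsGo-complete : ∀ b cs i k → bitL cs k ≡ b → k < length cs → i + k ∈ positionsGo b cs i
positionsGo-complete b (c ∷ cs) i zero cₖ _ with b Bool.≟ c
... | yes _  = here (+-identityʳ i)
... | no b≢c = contradiction (sym cₖ) b≢c
positionsGo-complete b (c ∷ cs) i (suc k) cₖ (s≤s k<) with b Bool.≟ c
... | yes _ = there (∈-+-suc (positionsGo-complete b cs (suc i) k cₖ k<))
... | no _  = ∈-+-suc (positionsGo-complete b cs (suc i) k cₖ k<)

positionsGo-≥ : ∀ b cs i → All (i ≤_) (positionsGo b cs i)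
positionsGo-≥ b []       i = []
positionsGo-≥ b (c ∷ cs) i with b Bool.≟ c
... | yes _ = ≤-refl ∷ All.map <⇒≤ (positionsGo-≥ b cs (suc i))
... | no _  = All.map <⇒≤ (positionsGo-≥ b cs (suc i))

positionsGo-sorted : ∀ b cs i → AllPairs _<_ (positionsGo b cs i)
positionsGo-sorted b []       i = []
positionsGo-sorted b (c ∷ cs) i with b Bool.≟ c
... | yes _ = positionsGo-≥ b cs (suc i) ∷ positionsGo-sorted b cs (suc i)
... | no _  = positionsGo-sorted b cs (suc i)

module _ {n} (w : Bits n) where
  private
    unmatched? : Decidable (_∉ matchedIdx (M w))
    unmatched? i = ¬? (i ∈? matchedIdx (M w))

    zeros : List ℕ
    zeros = positionsGo false (V.toList w) 0

  ∈-U₀⁻ : ∀ {q} → q ∈ U₀ w → bit w q ≡ false × q ∉ matchedIdx (M w) × q < n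
  ∈-U₀⁻ q∈ with ∈-filter⁻ unmatched? {xs = zeros} q∈
  ... | q∈zeros , q✗ with positionsGo-sound false (V.toList w) 0 q∈zeros
  ...   | q , refl , 0ᵠ , q< = 0ᵠ , q✗ , subst (q <_) (length-toList w) q<

  ∈-U₀⁺ : ∀ {q} → bit w q ≡ false → q ∉ matchedIdx (M w) → q < n → q ∈ U₀ w
  ∈-U₀⁺ {q} 0ᵠ q✗ q<n = ∈-filter⁺ unmatched? {xs = zeros}
    (positionsGo-complete false (V.toList w) 0 q 0ᵠ (subst (q <_) (sym (length-toList w)) q<n)) q✗

  U₀-sorted : AllPairs _<_ (U₀ w)
  U₀-sorted = AllPairs.filter⁺ unmatched? (positionsGo-sorted false (V.toList w) 0)

  U₀-head-≤ : ∀ {p rest q} → U₀ w ≡ p ∷ rest → q ∈ U₀ w → p ≤ q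
  U₀-head-≤ head q∈ with U₀ w | U₀-sorted
  U₀-head-≤ refl (here refl) | _ | _      = ≤-refl
  U₀-head-≤ refl (there q∈)  | _ | p< ∷ _ = <⇒≤ (All.lookup p< q∈)

  U₀-head-succ-zero : ∀ {p rest} → U₀ w ≡ p ∷ rest → bit w (suc p) ≡ false
  U₀-head-succ-zero {p} head with ∈-U₀⁻ (subst (p ∈_) (sym head) (here refl))
  ... | 0ᵖ , p✗ , _ = ¬-not (λ 1ᵖ⁺¹ → p✗ (zero-one-matched (V.toList w) 0 [] p 0ᵖ 1ᵖ⁺¹))

  -- If the bit before the leftmost unmatched 0 were a 0, it would be unmatched too.
  U₀-head-pred-one : ∀ {p rest} → U₀ w ≡ suc p ∷ rest → bit w p ≡ true
  U₀-head-pred-one {p} head with ∈-U₀⁻ (subst (suc p ∈_) (sym head) (here refl))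
  ... | 0ᵖ⁺¹ , p+1✗ , p+1<n =
    ¬-not λ 0ᵖ → <-irrefl refl (U₀-head-≤ head (∈-U₀⁺ 0ᵖ (p✗ 0ᵖ) (<-trans (n<1+n p) p+1<n)))
    where
    p✗ : bit w p ≡ false → p ∉ matchedIdx (M w)
    p✗ 0ᵖ p✓ = p+1✗ (zero-zero-matched-next (V.toList w) 0 [] [] p 0ᵖ 0ᵖ⁺¹ p✓)

infix 4 _⊑_ _↝_

_⊑_ : ∀ {n} → Bits n → Bits n → Set
a ⊑ b = ∀ q → bit a q ≡ true → bit b q ≡ true

_↝_ : ∀ {n} → Bits n → Bits n → Set
a ↝ b = ∃[ r ] b ≡ iter r τ a

Rises : ∀ {n} → Bits n → Bits n → ℕ → Set
Rises a b q = bit a q ≡ false × bit b q ≡ true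

iter-+ : ∀ {A : Set} (f : A → A) i j a → iter (i + j) f a ≡ iter i f (iter j f a)
iter-+ f zero    j a = refl
iter-+ f (suc i) j a = cong f (iter-+ f i j a)

iter-comm : ∀ {A : Set} (f : A → A) k a → iter k f (f a) ≡ f (iter k f a)
iter-comm f zero    a = refl
iter-comm f (suc k) a = cong f (iter-comm f k a)

iter-preserves : ∀ {A : Set} (P : A → Set) {f : A → A} → (∀ {a} → P a → P (f a)) →
                 ∀ k {a} → P a → P (iter k f a)
iter-preserves P pf zero    Pa = Pa
iter-preserves P pf (suc k) Pa = pf (iter-preserves P pf k Pa)

iter-injective : ∀ {A : Set} {f : A → A} → (∀ {a b} → f a ≡ f b → a ≡ b) →
                 ∀ k {a b} → iter k f a ≡ iter k f b → a ≡ b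
iter-injective inj zero    eq = eq
iter-injective inj (suc k) eq = iter-injective inj k (inj eq)

iter-∸ : ∀ {A : Set} (f : A → A) {i j} a → i ≤ j → iter j f a ≡ iter (j ∸ i) f (iter i f a)
iter-∸ f {i} {j} a i≤j = begin
  iter j f a                   ≡⟨ cong (λ k → iter k f a) (sym (m∸n+n≡m i≤j)) ⟩
  iter (j ∸ i + i) f a         ≡⟨ iter-+ f (j ∸ i) i a ⟩
  iter (j ∸ i) f (iter i f a)  ∎
  where open ≡-Reasoning

sameChain-sym : ∀ {n} {a b : Bits n} → SameChain a b → SameChain b a
sameChain-sym (z , bottom , on-a , on-b) = z , bottom , on-b , on-a

sameChain-↝ : ∀ {n} {a b : Bits n} → SameChain a b → a ↝ b ⊎ b ↝ a
sameChain-↝ (z , _ , (i , _ , refl) , (j , _ , refl)) with ≤-total i j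
... | inj₁ i≤j = inj₁ (j ∸ i , iter-∸ τ z i≤j)
... | inj₂ j≤i = inj₂ (i ∸ j , iter-∸ τ z j≤i)

setOne-⊒ : ∀ {n} p (w : Bits n) → w ⊑ setOne p w
setOne-⊒ p       []      q       1ᵠ = 1ᵠ
setOne-⊒ zero    (b ∷ w) zero    1ᵠ = refl
setOne-⊒ zero    (b ∷ w) (suc q) 1ᵠ = 1ᵠ
setOne-⊒ (suc p) (b ∷ w) zero    1ᵠ = 1ᵠ
setOne-⊒ (suc p) (b ∷ w) (suc q) 1ᵠ = setOne-⊒ p w q 1ᵠ

bit-setOne-≢ : ∀ {n} p (w : Bits n) q → q ≢ p → bit (setOne p w) q ≡ bit w q
bit-setOne-≢ p       []      q       _   = refl
bit-setOne-≢ zero    (b ∷ w) zero    q≢p = contradiction refl q≢p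
bit-setOne-≢ zero    (b ∷ w) (suc q) _   = refl
bit-setOne-≢ (suc p) (b ∷ w) zero    _   = refl
bit-setOne-≢ (suc p) (b ∷ w) (suc q) q≢p = bit-setOne-≢ p w q (q≢p ∘ cong suc)

τ-view : ∀ {n} (w : Bits n) → τ w ≡ w ⊎ ∃[ p ] ∃[ rest ] U₀ w ≡ p ∷ rest × τ w ≡ setOne p w
τ-view w with U₀ w
... | []       = inj₁ refl
... | p ∷ rest = inj₂ (p , rest , refl , refl)

τ-⊒ : ∀ {n} (w : Bits n) → w ⊑ τ w
τ-⊒ w q 1ᵠ with τ-view w
... | inj₁ τw≡w = subst (λ v → bit v q ≡ true) (sym τw≡w) 1ᵠ
... | inj₂ (p , _ , _ , τw≡) = subst (λ v → bit v q ≡ true) (sym τw≡) (setOne-⊒ p w q 1ᵠ)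

iter-τ-⊒ : ∀ {n} r (w : Bits n) → w ⊑ iter r τ w
iter-τ-⊒ zero    w q 1ᵠ = 1ᵠ
iter-τ-⊒ (suc r) w q 1ᵠ = τ-⊒ (iter r τ w) q (iter-τ-⊒ r w q 1ᵠ)

↝⇒⊑ : ∀ {n} {a b : Bits n} → a ↝ b → a ⊑ b
↝⇒⊑ (r , refl) = iter-τ-⊒ r _

rise-leftmost-unmatched : ∀ {n} {a b : Bits n} {p} → a ↝ b → Rises a b p →
                          ∃[ w ] (∃[ rest ] U₀ w ≡ p ∷ rest) × a ⊑ w × w ⊑ b
rise-leftmost-unmatched {a = a} {p = p} (r , refl) = go r
  where
  go : ∀ r → Rises a (iter r τ a) p → ∃[ w ] (∃[ rest ] U₀ w ≡ p ∷ rest) × a ⊑ w × w ⊑ iter r τ a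
  go zero    (0ᵖ , 1ᵖ) = contradiction (trans (sym 0ᵖ) 1ᵖ) λ ()
  go (suc r) (0ᵖ , 1ᵖ) with bit (iter r τ a) p in cᵖ
  ... | true with go r (0ᵖ , cᵖ)
  ...   | w , head , a⊑w , w⊑c = w , head , a⊑w , λ q → τ-⊒ (iter r τ a) q ∘ w⊑c q
  go (suc r) (0ᵖ , 1ᵖ) | false with τ-view (iter r τ a)
  ... | inj₁ τc≡c = contradiction (trans (sym cᵖ) (trans (cong (λ v → bit v p) (sym τc≡c)) 1ᵖ)) λ ()
  ... | inj₂ (p′ , rest , head , τc≡) with p ≟ p′
  ...   | yes refl = iter r τ a , (rest , head) , iter-τ-⊒ r a , τ-⊒ (iter r τ a)
  ...   | no p≢p′  = contradiction
    (trans (sym cᵖ) (trans (sym (bit-setOne-≢ p′ (iter r τ a) p p≢p′)) (trans (cong (λ v → bit v p) (sym τc≡)) 1ᵖ)))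
    λ ()

rise-pred-one : ∀ {n} {a b : Bits n} {p} → a ↝ b → Rises a b (suc p) → bit b p ≡ true
rise-pred-one {p = p} a↝b rise with rise-leftmost-unmatched a↝b rise
... | w , (_ , head) , _ , w⊑b = w⊑b p (U₀-head-pred-one w head)

rise-succ-zero : ∀ {n} {a b : Bits n} {p} → a ↝ b → Rises a b p → bit a (suc p) ≡ false
rise-succ-zero {p = p} a↝b rise with rise-leftmost-unmatched a↝b rise
... | w , (_ , head) , a⊑w , _ =
  ¬-not λ 1ᵖ⁺¹ → contradiction (trans (sym (a⊑w (suc p) 1ᵖ⁺¹)) (U₀-head-succ-zero w head)) λ ()

⊑-≢⇒rises : ∀ {n} {a b : Bits n} → a ⊑ b → a ≢ b → ∃[ d ] d < n × Rises a b d
⊑-≢⇒rises {a = []}        {[]}        _   a≢b = contradiction refl a≢b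
⊑-≢⇒rises {a = false ∷ a} {true ∷ b}  _   _   = zero , s≤s z≤n , refl , refl
⊑-≢⇒rises {a = true ∷ a}  {false ∷ b} a⊑b _   = contradiction (a⊑b zero refl) λ ()
⊑-≢⇒rises {a = false ∷ a} {false ∷ b} a⊑b a≢b =
  map suc (map₁ s≤s) (⊑-≢⇒rises (a⊑b ∘ suc) (a≢b ∘ cong (false ∷_)))
⊑-≢⇒rises {a = true ∷ a}  {true ∷ b}  a⊑b a≢b =
  map suc (map₁ s≤s) (⊑-≢⇒rises (a⊑b ∘ suc) (a≢b ∘ cong (true ∷_)))

σ-index : ℕ → ℕ → ℕ
σ-index n i with suc i ≟ n
... | yes _ = 0
... | no  _ = suc i

σ-index-< : ∀ {n i} → i < n → σ-index n i < n
σ-index-< {n} {i} i<n with suc i ≟ n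
... | yes _    = ≤-<-trans z≤n i<n
... | no  i+1≢n = ≤∧≢⇒< i<n i+1≢n

σ-index-suc : ∀ {n i} → suc i < n → σ-index n i ≡ suc i
σ-index-suc {n} {i} i+1<n with suc i ≟ n
... | yes refl = contradiction i+1<n (<-irrefl refl)
... | no  _    = refl

σ-index-cases : ∀ n i → σ-index n i ≡ 0 ⊎ σ-index n i ≡ suc i
σ-index-cases n i with suc i ≟ n
... | yes _ = inj₁ refl
... | no  _ = inj₂ refl

σ-index-injective : ∀ n {i j} → σ-index n i ≡ σ-index n j → i ≡ j
σ-index-injective n {i} {j} eq with suc i ≟ n | suc j ≟ n | eq
... | yes i+1≡n | yes j+1≡n | _  = suc-injective (trans i+1≡n (sym j+1≡n))
... | no  _     | no  _     | eq′ = suc-injective eq′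

bit-σ : ∀ {n} (v : Bits n) {i} → i < n → bit (σ v) (σ-index n i) ≡ bit v i
bit-σ {suc m} v@(_ ∷ _) {i} i<n with suc i ≟ suc m
... | yes refl  = sym (bit-last v)
... | no  i+1≢n = bit-init v i (≤∧≢⇒< (≤-pred i<n) (i+1≢n ∘ cong suc))

iter-σ-index-suc : ∀ {n} k {i} → suc i < n →
                   iter k (σ-index n) (suc i) ≡ 0 ⊎ iter k (σ-index n) (suc i) ≡ suc (iter k (σ-index n) i)
iter-σ-index-suc {n} k {i} i+1<n rewrite sym (σ-index-suc i+1<n) | iter-comm (σ-index n) k i =
  σ-index-cases n (iter k (σ-index n) i)

bit-iter-σ : ∀ {n} k (v : Bits n) {i} → i < n → bit (iter k σ v) (iter k (σ-index n) i) ≡ bit v i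
bit-iter-σ zero    v i<n = refl
bit-iter-σ (suc k) v i<n =
  trans (bit-σ (iter k σ v) (iter-preserves (_< _) σ-index-< k i<n)) (bit-iter-σ k v i<n)

module _ {P : ℕ → Set} (P? : Decidable P) where

  run-start : ∀ {d} → ¬ P 0 → P d → ∃[ u ] P (suc u) × ¬ P u × suc u ≤ d
  run-start {zero}  ¬P₀ P₀ = contradiction P₀ ¬P₀
  run-start {suc d} ¬P₀ Pd+1 with P? d
  ... | no ¬Pd = d , Pd+1 , ¬Pd , ≤-refl
  ... | yes Pd with run-start ¬P₀ Pd
  ...   | u , Pu+1 , ¬Pu , u<d = u , Pu+1 , ¬Pu , m≤n⇒m≤1+n u<d

  run-end : ∀ {d m} → P d → ¬ P m → d ≤ m → ∃[ v ] P v × ¬ P (suc v) × d ≤ v × suc v ≤ m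
  run-end {m = zero}  Pd ¬P₀ z≤n = contradiction Pd ¬P₀
  run-end {d} {suc m} Pd ¬Pm+1 d≤m+1 with ≤-pred (≤∧≢⇒< d≤m+1 λ { refl → ¬Pm+1 Pd }) | P? m
  ... | d≤m | yes Pm = m , Pm , ¬Pm+1 , d≤m , ≤-refl
  ... | d≤m | no ¬Pm with run-end Pd ¬Pm d≤m
  ...   | v , Pv , ¬Pv+1 , d≤v , v<m = v , Pv , ¬Pv+1 , d≤v , m≤n⇒m≤1+n v<m

rises? : ∀ {n} (a b : Bits n) → Decidable (Rises a b)
rises? a b q = (bit a q Bool.≟ false) ×-dec (bit b q Bool.≟ true)

¬rises⇒one : ∀ {n} {a b : Bits n} {q} → ¬ Rises a b q → bit b q ≡ true → bit a q ≡ true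
¬rises⇒one ¬rise 1ᵠ = ¬-not λ 0ᵠ → ¬rise (0ᵠ , 1ᵠ)

¬rises⇒zero : ∀ {n} {a b : Bits n} {q} → ¬ Rises a b q → bit a q ≡ false → bit b q ≡ false
¬rises⇒zero ¬rise 0ᵠ = ¬-not λ 1ᵠ → ¬rise (0ᵠ , 1ᵠ)

record RisingBlock {n} (x y : Bits n) : Set where
  field
    u v         : ℕ
    one-before  : bit x u ≡ true
    rises-first : Rises x y (suc u)
    rises-last  : Rises x y v
    zero-after  : bit y (suc v) ≡ false
    first≤last  : suc u ≤ v
    after<n     : suc v < n

rising-block : ∀ {m} {x y : Bits (suc m)} → x ↝ y → bit x 0 ≡ true → bit y m ≡ false → x ≢ y →
               RisingBlock x y
rising-block {x = x} {y} x↝y 1⁰ 0ᵐ x≢y with ⊑-≢⇒rises (↝⇒⊑ x↝y) x≢y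
... | d , d<n , rises-d
  with run-start (rises? x y) (λ (0⁰ , _) → contradiction (trans (sym 1⁰) 0⁰) λ ()) rises-d
     | run-end (rises? x y) rises-d (λ (_ , 1ᵐ) → contradiction (trans (sym 0ᵐ) 1ᵐ) λ ()) (≤-pred d<n)
... | u , rises-u+1 , ¬rises-u , u<d | v , rises-v , ¬rises-v+1 , d≤v , v<m = record
  { u           = u
  ; v           = v
  ; one-before  = ¬rises⇒one {a = x} {y} {u} ¬rises-u (rise-pred-one x↝y rises-u+1)
  ; rises-first = rises-u+1
  ; rises-last  = rises-v
  ; zero-after  = ¬rises⇒zero {a = x} {y} {suc v} ¬rises-v+1 (rise-succ-zero x↝y rises-v)
  ; first≤last  = ≤-trans u<d d≤v
  ; after<n     = s≤s v<m
  }

rising-block-finiteBlockCode : ∀ {m} {x y : Bits (suc m)} → x ↝ y →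
                               FiniteBlockCode x → FiniteBlockCode y → x ≢ y → RisingBlock x y
rising-block-finiteBlockCode x↝y fbc-x fbc-y =
  rising-block x↝y (proj₁ (finiteBlockCode-ends fbc-x)) (proj₂ (finiteBlockCode-ends fbc-y))

rotated-complements-not-on-chain : ∀ {m} {x y : Bits (suc m)} → RisingBlock x y → ∀ k →
                                   ¬ SameChain (iter k σ (comp x)) (iter k σ (comp y))
rotated-complements-not-on-chain {m} {x} {y} block k on-chain =
  <-irrefl (iter-injective (σ-index-injective n) k (trans ρ-first≡0 (sym ρ-after≡0))) (s≤s first≤last)
  where
  open RisingBlock block
  n = suc m
  ρ = iter k (σ-index n)
  s = iter k σ (comp x)
  t = iter k σ (comp y)

  v<n : v < n
  v<n = <-trans (n<1+n v) after<n

  first<n : suc u < n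
  first<n = ≤-<-trans first≤last v<n

  bit-s : ∀ {q} → q < n → bit s (ρ q) ≡ not (bit x q)
  bit-s {q} q<n = trans (bit-iter-σ k (comp x) q<n) (bit-comp x q q<n)

  bit-t : ∀ {q} → q < n → bit t (ρ q) ≡ not (bit y q)
  bit-t {q} q<n = trans (bit-iter-σ k (comp y) q<n) (bit-comp y q q<n)

  flipped : ∀ {q} → q < n → Rises x y q → Rises t s (ρ q)
  flipped q<n (0ᵠ , 1ᵠ) = trans (bit-t q<n) (cong not 1ᵠ) , trans (bit-s q<n) (cong not 0ᵠ)

  t↝s : t ↝ s
  t↝s with sameChain-↝ on-chain
  ... | inj₂ t↝s = t↝s
  ... | inj₁ s↝t with flipped first<n rises-first
  ...   | 0ᵗ , 1ˢ = contradiction (trans (sym (↝⇒⊑ s↝t _ 1ˢ)) 0ᵗ) λ ()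

  ρ-first≡0 : ρ (suc u) ≡ 0
  ρ-first≡0 with iter-σ-index-suc k first<n
  ... | inj₁ ≡0   = ≡0
  ... | inj₂ ≡suc = contradiction
    (trans (sym (rise-pred-one t↝s (subst (Rises t s) ≡suc (flipped first<n rises-first))))
           (trans (bit-s (<-trans (n<1+n u) first<n)) (cong not one-before)))
    λ ()

  ρ-after≡0 : ρ (suc v) ≡ 0
  ρ-after≡0 with iter-σ-index-suc k after<n
  ... | inj₁ ≡0   = ≡0
  ... | inj₂ ≡suc = contradiction
    (trans (sym (rise-succ-zero t↝s (flipped v<n rises-last)))
           (trans (cong (bit t) (sym ≡suc)) (trans (bit-t after<n) (cong not zero-after))))
    λ ()

proposition15 : (n : ℕ) → n ≥ 1 → (x y : Bits n) → ¬ (x ≡ y) →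
                FiniteBlockCode x → FiniteBlockCode y → SameChain x y →
                (k : ℕ) → ¬ SameChain (iter k σ (comp x)) (iter k σ (comp y))
proposition15 (suc m) _ x y x≢y fbc-x fbc-y on-chain k with sameChain-↝ on-chain
... | inj₁ x↝y =
  rotated-complements-not-on-chain (rising-block-finiteBlockCode x↝y fbc-x fbc-y x≢y) k
... | inj₂ y↝x =
  rotated-complements-not-on-chain (rising-block-finiteBlockCode y↝x fbc-y fbc-x (x≢y ∘ sym)) k
  ∘ sameChain-sym
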